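{- Let $D$ be a digraph of order $n$. (i) If $\Delta^+(D)\ge 1$, then $L_2(D)\ge \rho(D)+1$. (ii) If $\delta^-(D)\ge1$, then $\gamma_{\times2}(D)\ge \gamma(D)+1$. Both bounds are sharp (attained by some digraphs).
   Context: Digraphs are finite, without loops or multiple arcs (opposite arcs allowed). $\Delta^+(D)$ is the maximum out-degree, $\delta^-(D)$ the minimum in-degree. $N^+[v]=N^+(v)\cup\{v\}$ is the closed out-neighbourhood. A vertex dominates itself and its out-neighbours. A dominating set is a set $S$ such that every vertex is dominated by some vertex of $S$; $\gamma(D)$ is the minimum size of a dominating set. A packing is a set $B$ with $|N^+[v]\cap B|\le1$ for every vertex $v$; $\rho(D)$ is the maximum size of a packing. A $2$-limited packing is a set $B$ with $|N^+[v]\cap B|\le 2$ for every $v$; $L_2(D)$ is its maximum size. A double dominating set is a set $S$ such that every vertex is dominated by at least two vertices of $S$; $\gamma_{\times2}(D)$ is its minimum size. -}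

module Defs where

open import Data.Nat using (ℕ; _≤_; _+_)
open import Data.Bool using (Bool; true; false; _∨_)
open import Data.Fin using (Fin; _≟_)
open import Data.Fin.Subset using (Subset; _∈_; _∩_; ∣_∣)
open import Data.Vec using (tabulate)
open import Data.Product using (Σ; ∃; ∃-syntax; _×_)
open import Relation.Nullary using (¬_)
open import Relation.Nullary.Decidable using (⌊_⌋)
open import Relation.Binary.PropositionalEquality using (_≡_)

-- A digraph of order n on vertex set Fin n: arc u v = true iff there is an arc u → v.
-- No loops; no multiple arcs (a Boolean relation); opposite arcs allowed.
record Digraph (n : ℕ) : Set where
  field
    arc     : Fin n → Fin n → Bool
    loopless : ∀ v → arc v v ≡ false
open Digraph public

module _ {n : ℕ} (D : Digraph n) where

  outN : Fin n → Subset n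
  outN v = tabulate (λ u → arc D v u)

  inN : Fin n → Subset n
  inN v = tabulate (λ u → arc D u v)

  closedOut : Fin n → Subset n
  closedOut v = tabulate (λ u → ⌊ u ≟ v ⌋ ∨ arc D v u)

  outdeg indeg : Fin n → ℕ
  outdeg v = ∣ outN v ∣
  indeg v = ∣ inN v ∣

  MaxOutDeg≥1 : Set
  MaxOutDeg≥1 = ∃[ v ] 1 ≤ outdeg v

  MinInDeg≥1 : Set
  MinInDeg≥1 = ∀ v → 1 ≤ indeg v

  Dominating : Subset n → Set
  Dominating S = ∀ v → ∃[ u ] (u ∈ S × v ∈ closedOut u)

  DoubleDominating : Subset n → Set
  DoubleDominating S = ∀ v → ∃[ u ] ∃[ w ]
    (¬ (u ≡ w) × u ∈ S × w ∈ S × v ∈ closedOut u × v ∈ closedOut w)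

  Packing : Subset n → Set
  Packing B = ∀ v → ∣ closedOut v ∩ B ∣ ≤ 1

  TwoLimitedPacking : Subset n → Set
  TwoLimitedPacking B = ∀ v → ∣ closedOut v ∩ B ∣ ≤ 2

IsMaxSize : {n : ℕ} → (Subset n → Set) → ℕ → Set
IsMaxSize P k = (∃[ S ] (P S × ∣ S ∣ ≡ k)) × (∀ S → P S → ∣ S ∣ ≤ k)

IsMinSize : {n : ℕ} → (Subset n → Set) → ℕ → Set
IsMinSize P k = (∃[ S ] (P S × ∣ S ∣ ≡ k)) × (∀ S → P S → k ≤ ∣ S ∣)

IsRho IsL2 IsGamma IsGamma×2 : {n : ℕ} → Digraph n → ℕ → Set
IsRho D = IsMaxSize (Packing D)
IsL2 D = IsMaxSize (TwoLimitedPacking D)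
IsGamma D = IsMinSize (Dominating D)
IsGamma×2 D = IsMinSize (DoubleDominating D)

-- (i) A maximum packing B cannot contain every vertex: the tail v of an arc
-- v → u would see both v and u in N⁺[v] ∩ B.  Adding a vertex w ∉ B raises
-- each |N⁺[x] ∩ B| by at most one, so B ∪ {w} is a 2-limited packing of size
-- ρ + 1.  (ii) Deleting any vertex from a double dominating set leaves every
-- vertex with at least one of its two dominators, so γ ≤ γ×₂ − 1.
-- Both bounds are attained by the two-vertex digraphs 0 → 1 and 0 ⇄ 1.
module Submission where

open import Defs
open import Data.Bool using (Bool; true; false; _∨_)
open import Data.Bool.Properties using (∨-zeroʳ)
open import Data.Empty using (⊥-elim)
open import Data.Fin using (Fin; _≟_; fromℕ<) renaming (zero to fz; suc to fs)
open import Data.Fin.Subset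
  using (Subset; _∈_; _∉_; _⊆_; _∩_; _∪_; ∣_∣; ⁅_⁆; _-_; ∁; Nonempty; inside; outside)
open import Data.Fin.Subset.Properties
open import Data.Nat using (ℕ; _≤_; _<_; _+_; suc; z≤n; s≤s)
open import Data.Nat.Properties using (≤-refl; ≤-trans; n≤1+n; <⇒≱; +-comm; module ≤-Reasoning)
open import Data.Product using (_×_; ∃-syntax; _,_; proj₁; proj₂)
open import Data.Sum using (inj₁; inj₂)
open import Data.Vec using ([]; _∷_; here; there)
open import Data.Vec.Properties using (lookup∘tabulate; lookup⇒[]=; []=⇒lookup)
open import Relation.Binary.PropositionalEquality using (_≡_; _≢_; refl; sym; trans; subst; cong)
open import Relation.Nullary using (yes; no)
open import Relation.Nullary.Decidable using (⌊_⌋; isYes≗does; dec-true)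

private
  variable
    n : ℕ

1≤∣p∣⇒Nonempty : (p : Subset n) → 1 ≤ ∣ p ∣ → Nonempty p
1≤∣p∣⇒Nonempty (inside ∷ p) _ = fz , here
1≤∣p∣⇒Nonempty (outside ∷ p) h = let (x , x∈p) = 1≤∣p∣⇒Nonempty p h in fs x , there x∈p

x∈p⇒1≤∣p∣ : {p : Subset n} {x : Fin n} → x ∈ p → 1 ≤ ∣ p ∣
x∈p⇒1≤∣p∣ {p = p} {x} x∈p = subst (_≤ ∣ p ∣) (∣⁅x⁆∣≡1 x)
  (p⊆q⇒∣p∣≤∣q∣ λ y∈⁅x⁆ → subst (_∈ p) (sym (x∈⁅y⁆⇒x≡y x y∈⁅x⁆)) x∈p)

x,y∈p⇒2≤∣p∣ : {p : Subset n} {x y : Fin n} → x ∈ p → y ∈ p → x ≢ y → 2 ≤ ∣ p ∣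
x,y∈p⇒2≤∣p∣ x∈p y∈p x≢y =
  ≤-trans (s≤s (x∈p⇒1≤∣p∣ (x∈p∧x≢y⇒x∈p-y y∈p (λ y≡x → x≢y (sym y≡x))))) (x∈p⇒∣p-x∣<∣p∣ x∈p)

∣p∪⁅x⁆∣≤1+∣p∣ : (p : Subset n) (x : Fin n) → ∣ p ∪ ⁅ x ⁆ ∣ ≤ suc ∣ p ∣
∣p∪⁅x⁆∣≤1+∣p∣ (inside ∷ p) fz rewrite ∪-identityʳ p = n≤1+n _
∣p∪⁅x⁆∣≤1+∣p∣ (outside ∷ p) fz rewrite ∪-identityʳ p = ≤-refl
∣p∪⁅x⁆∣≤1+∣p∣ (inside ∷ p) (fs x) = s≤s (∣p∪⁅x⁆∣≤1+∣p∣ p x)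
∣p∪⁅x⁆∣≤1+∣p∣ (outside ∷ p) (fs x) = ∣p∪⁅x⁆∣≤1+∣p∣ p x

x∉p⇒∣p∣<∣p∪⁅x⁆∣ : {p : Subset n} {x : Fin n} → x ∉ p → ∣ p ∣ < ∣ p ∪ ⁅ x ⁆ ∣
x∉p⇒∣p∣<∣p∪⁅x⁆∣ {p = p} {x} x∉p = p⊂q⇒∣p∣<∣q∣ (p⊆p∪q ⁅ x ⁆ , x , x∈p∪q⁺ (inj₂ (x∈⁅x⁆ x)) , x∉p)

∣q∩[p∪⁅x⁆]∣≤1+∣q∩p∣ : (q p : Subset n) (x : Fin n) → ∣ q ∩ (p ∪ ⁅ x ⁆) ∣ ≤ suc ∣ q ∩ p ∣
∣q∩[p∪⁅x⁆]∣≤1+∣q∩p∣ q p x = ≤-trans (p⊆q⇒∣p∣≤∣q∣ ⊆[q∩p]∪⁅x⁆) (∣p∪⁅x⁆∣≤1+∣p∣ (q ∩ p) x)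
  where
  ⊆[q∩p]∪⁅x⁆ : q ∩ (p ∪ ⁅ x ⁆) ⊆ (q ∩ p) ∪ ⁅ x ⁆
  ⊆[q∩p]∪⁅x⁆ {y} y∈ with x∈p∩q⁻ q _ y∈
  ... | y∈q , y∈p∪⁅x⁆ with x∈p∪q⁻ p ⁅ x ⁆ y∈p∪⁅x⁆
  ...   | inj₁ y∈p = x∈p∪q⁺ (inj₁ (x∈p∩q⁺ (y∈q , y∈p)))
  ...   | inj₂ y∈⁅x⁆ = x∈p∪q⁺ (inj₂ y∈⁅x⁆)

module _ (D : Digraph n) where

  ∈closedOut⁺ : {u v : Fin n} → ⌊ u ≟ v ⌋ ∨ arc D v u ≡ true → u ∈ closedOut D v
  ∈closedOut⁺ {u} {v} h = lookup⇒[]= u _ (trans (lookup∘tabulate _ u) h)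

  v∈closedOut[v] : (v : Fin n) → v ∈ closedOut D v
  v∈closedOut[v] v = ∈closedOut⁺ {v} {v}
    (cong (_∨ arc D v v) (trans (isYes≗does (v ≟ v)) (dec-true (v ≟ v) refl)))

  arc⇒∈closedOut : {u v : Fin n} → arc D v u ≡ true → u ∈ closedOut D v
  arc⇒∈closedOut {u} {v} vu = ∈closedOut⁺ (trans (cong (⌊ u ≟ v ⌋ ∨_) vu) (∨-zeroʳ _))

  ∈outN⇒arc : {u v : Fin n} → u ∈ outN D v → arc D v u ≡ true
  ∈outN⇒arc {u} {v} u∈ = trans (sym (lookup∘tabulate _ u)) ([]=⇒lookup u∈)

  arc⇒≢ : {u v : Fin n} → arc D v u ≡ true → v ≢ u
  arc⇒≢ {v = v} vu refl with () ← trans (sym vu) (loopless D v)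

  packing-misses-vertex : MaxOutDeg≥1 D → {B : Subset n} → Packing D B → ∃[ w ] w ∉ B
  packing-misses-vertex (v , 1≤outdeg) {B} pk with nonempty? (∁ B)
  ... | yes (w , w∈∁B) = w , x∈∁p⇒x∉p w∈∁B
  ... | no ∁B-empty = ⊥-elim (<⇒≱ (x,y∈p⇒2≤∣p∣ (in-both v∈) (in-both u∈) (arc⇒≢ vu)) (pk v))
    where
    u = proj₁ (1≤∣p∣⇒Nonempty (outN D v) 1≤outdeg)
    vu : arc D v u ≡ true
    vu = ∈outN⇒arc (proj₂ (1≤∣p∣⇒Nonempty (outN D v) 1≤outdeg))
    v∈ = v∈closedOut[v] v
    u∈ = arc⇒∈closedOut vu
    in-both : {x : Fin n} → x ∈ closedOut D v → x ∈ closedOut D v ∩ B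
    in-both {x} x∈ = x∈p∩q⁺ (x∈ , x∉∁p⇒x∈p λ x∈∁B → ∁B-empty (x , x∈∁B))

  packing∪⁅w⁆-twoLimited : {B : Subset n} → Packing D B → (w : Fin n) →
                           TwoLimitedPacking D (B ∪ ⁅ w ⁆)
  packing∪⁅w⁆-twoLimited {B} pk w x = ≤-trans (∣q∩[p∪⁅x⁆]∣≤1+∣q∩p∣ (closedOut D x) B w) (s≤s (pk x))

  ρ+1≤L₂ : MaxOutDeg≥1 D → {r l : ℕ} → IsRho D r → IsL2 D l → r + 1 ≤ l
  ρ+1≤L₂ Δ⁺≥1 {l = l} ((B , pk , refl) , _) (_ , L₂-max) = begin
    ∣ B ∣ + 1         ≡⟨ +-comm ∣ B ∣ 1 ⟩
    suc ∣ B ∣         ≤⟨ x∉p⇒∣p∣<∣p∪⁅x⁆∣ w∉B ⟩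
    ∣ B ∪ ⁅ w ⁆ ∣     ≤⟨ L₂-max _ (packing∪⁅w⁆-twoLimited pk w) ⟩
    l                 ∎
    where
    open ≤-Reasoning
    w = proj₁ (packing-misses-vertex Δ⁺≥1 pk)
    w∉B = proj₂ (packing-misses-vertex Δ⁺≥1 pk)

  dominating⇒1≤∣S∣ : Fin n → {S : Subset n} → Dominating D S → 1 ≤ ∣ S ∣
  dominating⇒1≤∣S∣ v dom = x∈p⇒1≤∣p∣ (proj₁ (proj₂ (dom v)))

  doubleDominating⇒2≤∣S∣ : Fin n → {S : Subset n} → DoubleDominating D S → 2 ≤ ∣ S ∣
  doubleDominating⇒2≤∣S∣ v dd with dd v
  ... | u , w , u≢w , u∈S , w∈S , _ = x,y∈p⇒2≤∣p∣ u∈S w∈S u≢w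

  doubleDominating-w⇒dominating : {S : Subset n} → DoubleDominating D S →
                                 (w : Fin n) → Dominating D (S - w)
  doubleDominating-w⇒dominating dd w v with dd v
  ... | u , u′ , u≢u′ , u∈S , u′∈S , v∈N[u] , v∈N[u′] with u ≟ w
  ...   | yes refl = u′ , x∈p∧x≢y⇒x∈p-y u′∈S (λ u′≡u → u≢u′ (sym u′≡u)) , v∈N[u′]
  ...   | no u≢w = u , x∈p∧x≢y⇒x∈p-y u∈S u≢w , v∈N[u]

  γ+1≤γ×₂ : Fin n → {g g₂ : ℕ} → IsGamma D g → IsGamma×2 D g₂ → g + 1 ≤ g₂
  γ+1≤γ×₂ v {g} (_ , γ-min) ((S , dd , refl) , _) = begin
    g + 1             ≡⟨ +-comm g 1 ⟩
    suc g             ≤⟨ s≤s (γ-min (S - w) (doubleDominating-w⇒dominating dd w)) ⟩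
    suc ∣ S - w ∣     ≤⟨ x∈p⇒∣p-x∣<∣p∣ w∈S ⟩
    ∣ S ∣             ∎
    where
    open ≤-Reasoning
    w = proj₁ (dd v)
    w∈S = proj₁ (proj₂ (proj₂ (proj₂ (dd v))))

  universal-vertex⇒∣packing∣≤1 : {v : Fin n} → (∀ u → u ∈ closedOut D v) →
                                {B : Subset n} → Packing D B → ∣ B ∣ ≤ 1
  universal-vertex⇒∣packing∣≤1 {v} v⇒all {B} pk =
    ≤-trans (p⊆q⇒∣p∣≤∣q∣ λ {u} u∈B → x∈p∩q⁺ (v⇒all u , u∈B)) (pk v)

singleArc : Digraph 2
singleArc = record { arc = arc′ ; loopless = λ { fz → refl ; (fs fz) → refl } }
  where
  arc′ : Fin 2 → Fin 2 → Bool
  arc′ fz (fs fz) = true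
  arc′ _  _       = false

twoCycle : Digraph 2
twoCycle = record { arc = arc′ ; loopless = λ { fz → refl ; (fs fz) → refl } }
  where
  arc′ : Fin 2 → Fin 2 → Bool
  arc′ fz      (fs fz) = true
  arc′ (fs fz) fz      = true
  arc′ _       _       = false

ρ[singleArc]≡1 : IsRho singleArc 1
ρ[singleArc]≡1 =
  ((inside ∷ outside ∷ []) , (λ { fz → s≤s z≤n ; (fs fz) → z≤n }) , refl)
  , λ B → universal-vertex⇒∣packing∣≤1 singleArc {fz} (λ { fz → here ; (fs fz) → there here }) {B}

L₂[singleArc]≡2 : IsL2 singleArc 2
L₂[singleArc]≡2 =
  ((inside ∷ inside ∷ []) , (λ { fz → s≤s (s≤s z≤n) ; (fs fz) → s≤s z≤n }) , refl)
  , λ B _ → ∣p∣≤n B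

γ[twoCycle]≡1 : IsGamma twoCycle 1
γ[twoCycle]≡1 =
  ((inside ∷ outside ∷ []) , (λ { fz → fz , here , here ; (fs fz) → fz , here , there here }) , refl)
  , λ S → dominating⇒1≤∣S∣ twoCycle fz

γ×₂[twoCycle]≡2 : IsGamma×2 twoCycle 2
γ×₂[twoCycle]≡2 =
  ((inside ∷ inside ∷ [])
  , (λ { fz      → fz , fs fz , (λ ()) , here , there here , here , here
       ; (fs fz) → fz , fs fz , (λ ()) , here , there here , there here , there here })
  , refl)
  , λ S → doubleDominating⇒2≤∣S∣ twoCycle fz

-- The hypothesis δ⁻(D) ≥ 1 of (ii) only guarantees that a double dominating set
-- exists; here that is already part of IsGamma×2.
proposition1 :
    -- (i) Δ⁺(D) ≥ 1 ⇒ L₂(D) ≥ ρ(D) + 1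
    ((n : ℕ) (D : Digraph n) → MaxOutDeg≥1 D →
      ∀ r l → IsRho D r → IsL2 D l → r + 1 ≤ l)
    ×
    -- (ii) δ⁻(D) ≥ 1 ⇒ γ×₂(D) ≥ γ(D) + 1   (order n ≥ 1)
    ((n : ℕ) (D : Digraph n) → 1 ≤ n → MinInDeg≥1 D →
      ∀ g g₂ → IsGamma D g → IsGamma×2 D g₂ → g + 1 ≤ g₂)
    ×
    -- sharpness of (i)
    (∃[ n ] ∃[ D ] (MaxOutDeg≥1 {n} D × ∃[ r ] ∃[ l ]
      (IsRho D r × IsL2 D l × l ≡ r + 1)))
    ×
    -- sharpness of (ii)
    (∃[ n ] ∃[ D ] (1 ≤ n × MinInDeg≥1 {n} D × ∃[ g ] ∃[ g₂ ]
      (IsGamma D g × IsGamma×2 D g₂ × g₂ ≡ g + 1)))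
proposition1 =
    (λ n D Δ⁺≥1 r l → ρ+1≤L₂ D Δ⁺≥1)
  , (λ n D 1≤n _ g g₂ → γ+1≤γ×₂ D (fromℕ< 1≤n))
  , (2 , singleArc , (fz , s≤s z≤n) , 1 , 2 , ρ[singleArc]≡1 , L₂[singleArc]≡2 , refl)
  , (2 , twoCycle , s≤s z≤n , (λ { fz → s≤s z≤n ; (fs fz) → s≤s z≤n })
      , 1 , 2 , γ[twoCycle]≡1 , γ×₂[twoCycle]≡2 , refl)
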